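{- Let $k\ge 2$ be an integer and let $F$ be a $(k+2,k)$-free $3$-uniform hypergraph that is also $(\ell+1,\ell)$-free for all $\ell\in[2,k-1]$. Then $$e(F)\le \frac{k-1}{2k-1}\binom{v(F)}{2}\le \frac{k-1}{4k-2}\,v(F)^2.$$
   Context: All hypergraphs are finite with edges forming a set. In a $3$-uniform hypergraph, an $(s,k)$-configuration is a collection of $k$ edges whose union has at most $s$ vertices; a hypergraph is $(s,k)$-free if it contains no $(s,k)$-configuration. $v(F)$ and $e(F)$ denote the numbers of vertices and edges of $F$. -}

module Defs where

open import Data.Nat using (ℕ; _≤_)
open import Data.List using (List; length)
open import Data.List.Relation.Unary.All using (All)
open import Data.List.Relation.Unary.Unique.Propositional using (Unique)
open import Data.List.Membership.Propositional using (_∈_)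
open import Data.Fin.Subset using (Subset; ∣_∣; ⋃)
open import Data.Product using (Σ; _×_)
open import Relation.Binary.PropositionalEquality using (_≡_)
open import Relation.Nullary using (¬_)

record Hypergraph3 (n : ℕ) : Set where
  field
    edges    : List (Subset n)
    uniform  : All (λ e → ∣ e ∣ ≡ 3) edges
    distinct : Unique edges
open Hypergraph3 public

v : ∀ {n} → Hypergraph3 n → ℕ
v {n} _ = n

e : ∀ {n} → Hypergraph3 n → ℕ
e F = length (edges F)

Configuration : ∀ {n} → Hypergraph3 n → ℕ → ℕ → Set
Configuration {n} F s k =
  Σ (List (Subset n)) λ C →
    All (_∈ edges F) C × Unique C × length C ≡ k × ∣ ⋃ C ∣ ≤ s

Free : ∀ {n} → Hypergraph3 n → ℕ → ℕ → Set
Free F s k = ¬ Configuration F s k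

module Submission where

-- Count the ordered pairs of distinct vertices lying in a common edge. Grow a
-- cluster from one edge by repeatedly adding an edge that shares a pair with it.
-- Each addition brings at most one new vertex, so (k+2,k)-freeness stops the
-- growth before k edges, while (l+1,l)-freeness forces every addition to bring
-- a new vertex and hence four new ordered pairs. A finished cluster of c ≤ k-1
-- edges thus covers at least 4c+2 ≥ (4k-2)c/(k-1) ordered pairs, none of them
-- covered by the remaining edges, and induction on the remaining edges gives
-- (4k-2) e(F) ≤ (k-1) n(n-1). The second inequality is 2·C(n,2) ≤ n².

open import Defs

open import Level using (Level; 0ℓ)
open import Data.Nat using (ℕ; zero; suc; _≤_; _<_; _+_; _*_; _∸_; z≤n; s≤s)
open import Data.Nat.Properties hiding (_≟_)
open import Data.Fin using (Fin; zero; suc; _≟_)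
open import Data.Fin.Properties using (any?)
open import Data.Fin.Subset using (Subset; _∈_; _∉_; ∣_∣; _∪_; ⋃; ⁅_⁆; inside; outside)
open import Data.Fin.Subset.Properties using (_∈?_; x∈⁅y⁆⇔x≡y; ∣⁅x⁆∣≡1; x∈p∪q⁺; x∈p∪q⁻; p⊆q⇒∣p∣≤∣q∣; ∪-identityʳ)
open import Data.Product using (_×_; _,_; proj₁; proj₂; ∃; ∃₂)
open import Data.Sum using (inj₁; inj₂; [_,_]′)
open import Data.Empty using (⊥-elim)
open import Data.Vec using (_∷_; [])
open import Function using (_∘_; Equivalence)
open import Relation.Nullary using (¬_; Dec; yes; no; does)
open import Relation.Nullary.Decidable using (_×-dec_; ¬?)
open import Data.Bool using (if_then_else_)
open import Relation.Unary using (Pred; Decidable; _⊆_; _≐_; ∁; _∩_) renaming (_⊥_ to Disjoint)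
import Relation.Unary as U
open import Relation.Unary.Properties using (_∪?_; ∁?; _∩?_)
open import Relation.Binary.PropositionalEquality using (_≡_; _≢_; refl; sym; trans; cong; cong₂; subst; module ≡-Reasoning)
open import Algebra.Properties.Semiring.Sum +-*-semiring using (sum; sum-cong-≗; ∑-distrib-+; sum-syntax; *-distribˡ-sum)
open import Data.List using (List; []; _∷_; _++_; [_]; length)
open import Data.List.Relation.Unary.Any using (Any; here; there) renaming (any? to anyₗ?)
import Data.List.Relation.Unary.Any.Properties as Any
open import Data.List.Membership.Propositional using (find; lose) renaming (_∈_ to _∈ₗ_)
open import Data.List.Relation.Binary.Permutation.Propositional using (_↭_; ↭-refl; ↭-sym; ↭-trans; ↭⇒↭ₛ)
import Data.List.Relation.Binary.Permutation.Setoid.Properties as Permutationₛ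
open import Data.List.Relation.Unary.All using (All; []; _∷_)
import Data.List.Relation.Unary.All as All
import Data.List.Relation.Unary.All.Properties as All
open import Data.List.Relation.Unary.AllPairs using ([]; _∷_)
open import Data.List.Relation.Unary.Unique.Propositional using (Unique)
open import Data.List.Membership.Propositional.Properties using (∈-∃++)
open import Data.Nat.Induction using (<-wellFounded)
open import Data.Nat.Tactic.RingSolver using (solve-∀)
open import Induction.WellFounded using (Acc; acc)
open import Relation.Binary.PropositionalEquality using (setoid)
open import Data.List.Relation.Binary.Permutation.Propositional.Properties using (Any-resp-↭; All-resp-↭; ↭-length; ++⁺ˡ; shift)
open import Data.List.Properties using (length-++; length-++-sucʳ)

private
  variable
    ℓ ℓ′ ℓ″ : Level
    n : ℕ
    P : Pred (Fin n) ℓ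
    Q : Pred (Fin n) ℓ′
    R : Pred (Fin n) ℓ″

Unique-++⁻ : {A : Set} (xs : List A) {ys : List A} → Unique (xs ++ ys) → Unique xs × Unique ys
Unique-++⁻ []       u        = [] , u
Unique-++⁻ (x ∷ xs) (x∉ ∷ u) with Unique-++⁻ xs u
... | uxs , uys = All.++⁻ˡ xs x∉ ∷ uxs , uys

Unique-resp-↭ : {A : Set} {xs ys : List A} → xs ↭ ys → Unique xs → Unique ys
Unique-resp-↭ {A} xs↭ys = Permutationₛ.Unique-resp-↭ (setoid A) (↭⇒↭ₛ xs↭ys)

-- Counting decidable predicates on Fin n

sum-mono-≤ : {f g : Fin n → ℕ} → (∀ i → f i ≤ g i) → sum f ≤ sum g
sum-mono-≤ {zero}  _  = z≤n
sum-mono-≤ {suc n} f≤g = +-mono-≤ (f≤g zero) (sum-mono-≤ (f≤g ∘ suc))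

sum-const : ∀ n c → ∑[ i < n ] c ≡ n * c
sum-const zero    c = refl
sum-const (suc n) c = cong (c +_) (sum-const n c)

-- Defined through does, not by matching on yes/no, so that it computes on
-- deciders built with Dec.map′ such as _∈?_.
𝟙 : {A : Set ℓ} → Dec A → ℕ
𝟙 d = if does d then 1 else 0

count : {P : Pred (Fin n) ℓ} → Decidable P → ℕ
count {n = n} P? = ∑[ i < n ] 𝟙 (P? i)

count-mono : (P? : Decidable P) (Q? : Decidable Q) → P ⊆ Q → count P? ≤ count Q?
count-mono P? Q? P⊆Q = sum-mono-≤ 𝟙-mono
  where
  𝟙-mono : ∀ i → 𝟙 (P? i) ≤ 𝟙 (Q? i)
  𝟙-mono i with P? i | Q? i
  ... | yes p | no ¬q = ⊥-elim (¬q (P⊆Q p))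
  ... | yes _ | yes _ = ≤-refl
  ... | no _  | _     = z≤n

count-cong : (P? : Decidable P) (Q? : Decidable Q) → P ≐ Q → count P? ≡ count Q?
count-cong P? Q? (P⊆Q , Q⊆P) = ≤-antisym (count-mono P? Q? P⊆Q) (count-mono Q? P? Q⊆P)

count-∪ : (P? : Decidable P) (Q? : Decidable Q) → Disjoint P Q →
          count (P? ∪? Q?) ≡ count P? + count Q?
count-∪ P? Q? P⊥Q = trans (sum-cong-≗ 𝟙-∪) (∑-distrib-+ (𝟙 ∘ P?) (𝟙 ∘ Q?))
  where
  𝟙-∪ : ∀ i → 𝟙 ((P? ∪? Q?) i) ≡ 𝟙 (P? i) + 𝟙 (Q? i)
  𝟙-∪ i with P? i | Q? i
  ... | yes p | yes q = ⊥-elim (P⊥Q (p , q))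
  ... | yes _ | no _  = refl
  ... | no _  | yes _ = refl
  ... | no _  | no _  = refl

count-∪-≤ : (P? : Decidable P) (Q? : Decidable Q) (R? : Decidable R) →
            Disjoint P Q → P ⊆ R → Q ⊆ R → count P? + count Q? ≤ count R?
count-∪-≤ P? Q? R? P⊥Q P⊆R Q⊆R = begin
  count P? + count Q?  ≡⟨ count-∪ P? Q? P⊥Q ⟨
  count (P? ∪? Q?)     ≤⟨ count-mono (P? ∪? Q?) R? [ P⊆R , Q⊆R ]′ ⟩
  count R?             ∎
  where open ≤-Reasoning

count≤n : ∀ {n} {P : Pred (Fin n) ℓ} (P? : Decidable P) → count P? ≤ n
count≤n {n = n} P? = ≤-trans (sum-mono-≤ 𝟙≤1) (≤-reflexive (trans (sum-const n 1) (*-identityʳ n)))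
  where
  𝟙≤1 : ∀ i → 𝟙 (P? i) ≤ 1
  𝟙≤1 i with P? i
  ... | yes _ = ≤-refl
  ... | no _  = z≤n

count-∈ : (p : Subset n) → count (_∈? p) ≡ ∣ p ∣
count-∈ []            = refl
count-∈ (inside ∷ p)  = cong suc (count-∈ p)
count-∈ (outside ∷ p) = count-∈ p

count-≡ : (w : Fin n) → count (_≟ w) ≡ 1
count-≡ w = begin
  count (_≟ w)       ≡⟨ count-cong (_≟ w) (_∈? ⁅ w ⁆) (Equivalence.from x∈⁅y⁆⇔x≡y , Equivalence.to x∈⁅y⁆⇔x≡y) ⟩
  count (_∈? ⁅ w ⁆)  ≡⟨ count-∈ ⁅ w ⁆ ⟩
  ∣ ⁅ w ⁆ ∣          ≡⟨ ∣⁅x⁆∣≡1 w ⟩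
  1                  ∎
  where open ≡-Reasoning

count-others : {E : Subset n} {i : Fin n} → i ∈ E → count (∁? (i ≟_) ∩? (_∈? E)) + 1 ≡ ∣ E ∣
count-others {E = E} {i} i∈E = begin
  count others + 1              ≡⟨ cong (count others +_) (count-≡ i) ⟨
  count others + count (_≟ i)   ≡⟨ count-∪ others (_≟ i) (λ ((i≢j , _) , j≡i) → i≢j (sym j≡i)) ⟨
  count (others ∪? (_≟ i))      ≡⟨ count-cong (others ∪? (_≟ i)) (_∈? E) (others∪i⊆E , E⊆others∪i) ⟩
  count (_∈? E)                 ≡⟨ count-∈ E ⟩
  ∣ E ∣                         ∎
  where
  open ≡-Reasoning
  others : Decidable (∁ (i ≡_) ∩ (_∈ E))
  others = ∁? (i ≟_) ∩? (_∈? E)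
  others∪i⊆E : (∁ (i ≡_) ∩ (_∈ E)) U.∪ (_≡ i) ⊆ (_∈ E)
  others∪i⊆E (inj₁ (_ , j∈E)) = j∈E
  others∪i⊆E (inj₂ refl)      = i∈E
  E⊆others∪i : (_∈ E) ⊆ (∁ (i ≡_) ∩ (_∈ E)) U.∪ (_≡ i)
  E⊆others∪i {j} j∈E with i ≟ j
  ... | yes refl = inj₂ refl
  ... | no i≢j   = inj₁ (i≢j , j∈E)

SharePair : Subset n → Subset n → Set
SharePair E E′ = ∃₂ λ a b → a ≢ b × (a ∈ E × b ∈ E) × (a ∈ E′ × b ∈ E′)

sharePair? : (E E′ : Subset n) → Dec (SharePair E E′)
sharePair? E E′ = any? λ a → any? λ b →
  ¬? (a ≟ b) ×-dec (a ∈? E ×-dec b ∈? E) ×-dec (a ∈? E′ ×-dec b ∈? E′)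

module _ (E U : Subset n) where

  sharePair⇒∣E∪U∣+2≤∣E∣+∣U∣ : SharePair E U → ∣ E ∪ U ∣ + 2 ≤ ∣ E ∣ + ∣ U ∣
  sharePair⇒∣E∪U∣+2≤∣E∣+∣U∣ (a , b , a≢b , (a∈E , b∈E) , (a∈U , b∈U)) = begin
    ∣ E ∪ U ∣ + 2                  ≡⟨ cong (_+ 2) (count-∈ (E ∪ U)) ⟨
    count (_∈? E ∪ U) + 2          ≤⟨ +-monoˡ-≤ 2 (count-mono (_∈? E ∪ U) (new ∪? (_∈? U)) E∪U⊆new∪U) ⟩
    count (new ∪? (_∈? U)) + 2     ≡⟨ cong (_+ 2) (count-∪ new (_∈? U) (λ ((_ , x∉U) , x∈U) → x∉U x∈U)) ⟩
    count new + count (_∈? U) + 2  ≡⟨ regroup (count new) (count (_∈? U)) ⟩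
    (2 + count new) + count (_∈? U) ≤⟨ +-mono-≤ 2+new≤∣E∣ (≤-reflexive (count-∈ U)) ⟩
    ∣ E ∣ + ∣ U ∣                  ∎
    where
    open ≤-Reasoning
    regroup : ∀ x u → x + u + 2 ≡ (2 + x) + u
    regroup = solve-∀
    new : Decidable ((_∈ E) ∩ ∁ (_∈ U))
    new = (_∈? E) ∩? ∁? (_∈? U)
    E∪U⊆new∪U : (_∈ E ∪ U) ⊆ ((_∈ E) ∩ ∁ (_∈ U)) U.∪ (_∈ U)
    E∪U⊆new∪U {x} x∈E∪U with x ∈? U
    ... | yes x∈U = inj₂ x∈U
    ... | no x∉U  = [ (λ x∈E → inj₁ (x∈E , x∉U)) , (λ x∈U → ⊥-elim (x∉U x∈U)) ]′ (x∈p∪q⁻ E U x∈E∪U)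
    a-or-b : Decidable ((_≡ a) U.∪ (_≡ b))
    a-or-b = (_≟ a) ∪? (_≟ b)
    2+new≤∣E∣ : 2 + count new ≤ ∣ E ∣
    2+new≤∣E∣ = begin
      2 + count new              ≡⟨ cong (_+ count new) (cong₂ _+_ (count-≡ a) (count-≡ b)) ⟨
      count (_≟ a) + count (_≟ b) + count new
        ≡⟨ cong (_+ count new) (count-∪ (_≟ a) (_≟ b) (λ (x≡a , x≡b) → a≢b (trans (sym x≡a) x≡b))) ⟨
      count a-or-b + count new   ≤⟨ count-∪-≤ a-or-b new (_∈? E)
                                      (λ { (inj₁ refl , _ , a∉U) → a∉U a∈U ; (inj₂ refl , _ , b∉U) → b∉U b∈U })
                                      [ (λ { refl → a∈E }) , (λ { refl → b∈E }) ]′ proj₁ ⟩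
      count (_∈? E)              ≡⟨ count-∈ E ⟩
      ∣ E ∣                      ∎

  ∣U∣<∣E∪U∣⇒∃∈E∖U : ∣ U ∣ < ∣ E ∪ U ∣ → ∃ λ w → w ∈ E × w ∉ U
  ∣U∣<∣E∪U∣⇒∃∈E∖U ∣U∣<∣E∪U∣ with any? (λ w → w ∈? E ×-dec ¬? (w ∈? U))
  ... | yes E∖U≢∅ = E∖U≢∅
  ... | no  E∖U≡∅ = ⊥-elim (<⇒≱ ∣U∣<∣E∪U∣ (p⊆q⇒∣p∣≤∣q∣ E∪U⊆U))
    where
    E∪U⊆U : ∀ {x} → x ∈ E ∪ U → x ∈ U
    E∪U⊆U {x} x∈E∪U with x ∈? U
    ... | yes x∈U = x∈U
    ... | no x∉U  = [ (λ x∈E → ⊥-elim (E∖U≡∅ (x , x∈E , x∉U))) , (λ x∈U → x∈U) ]′ (x∈p∪q⁻ E U x∈E∪U)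

∈⋃⁺ : {C : List (Subset n)} {E : Subset n} {x : Fin n} → E ∈ₗ C → x ∈ E → x ∈ ⋃ C
∈⋃⁺ (here refl)  x∈E = x∈p∪q⁺ (inj₁ x∈E)
∈⋃⁺ (there E∈C) x∈E = x∈p∪q⁺ (inj₂ (∈⋃⁺ E∈C x∈E))

sharePair-⋃⁺ : {C : List (Subset n)} {E : Subset n} → Any (SharePair E) C → SharePair E (⋃ C)
sharePair-⋃⁺ share with find share
... | E′ , E′∈C , a , b , a≢b , ab∈E , (a∈E′ , b∈E′) = a , b , a≢b , ab∈E , (∈⋃⁺ E′∈C a∈E′ , ∈⋃⁺ E′∈C b∈E′)

-- Pairs covered by a list of edges

module _ {n : ℕ} where

  Adjacent : List (Subset n) → Fin n → Pred (Fin n) 0ℓ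
  Adjacent L i j = i ≢ j × Any (λ E → i ∈ E × j ∈ E) L

  adjacent? : (L : List (Subset n)) (i : Fin n) → Decidable (Adjacent L i)
  adjacent? L i j = ¬? (i ≟ j) ×-dec anyₗ? (λ E → i ∈? E ×-dec j ∈? E) L

  degree : List (Subset n) → Fin n → ℕ
  degree L i = count (adjacent? L i)

  -- Counts ordered pairs, so it is twice the size of the 2-shadow of L.
  pairsCovered : List (Subset n) → ℕ
  pairsCovered L = ∑[ i < n ] degree L i

  adjacent⇒∈⋃ : {L : List (Subset n)} {i j : Fin n} → Adjacent L i j → i ∈ ⋃ L × j ∈ ⋃ L
  adjacent⇒∈⋃ (_ , covered) with find covered
  ... | E , E∈L , i∈E , j∈E = ∈⋃⁺ E∈L i∈E , ∈⋃⁺ E∈L j∈E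

  pairsCovered-↭ : {L L′ : List (Subset n)} → L ↭ L′ → pairsCovered L ≡ pairsCovered L′
  pairsCovered-↭ L↭L′ = sum-cong-≗ λ i →
    count-cong (adjacent? _ i) (adjacent? _ i)
      ( (λ (i≢j , c) → i≢j , Any-resp-↭ L↭L′ c)
      , (λ (i≢j , c) → i≢j , Any-resp-↭ (↭-sym L↭L′) c))

  degree+1≤n : (L : List (Subset n)) (i : Fin n) → degree L i + 1 ≤ n
  degree+1≤n L i = begin
    degree L i + 1                           ≡⟨ cong (degree L i +_) (count-≡ i) ⟨
    count (adjacent? L i) + count (_≟ i)     ≡⟨ count-∪ (adjacent? L i) (_≟ i) (λ ((i≢j , _) , j≡i) → i≢j (sym j≡i)) ⟨
    count (adjacent? L i ∪? (_≟ i))          ≤⟨ count≤n (adjacent? L i ∪? (_≟ i)) ⟩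
    n                                        ∎
    where open ≤-Reasoning

  pairsCovered+n≤n*n : (L : List (Subset n)) → pairsCovered L + n ≤ n * n
  pairsCovered+n≤n*n L = begin
    pairsCovered L + n                 ≡⟨ cong (pairsCovered L +_) (trans (sum-const n 1) (*-identityʳ n)) ⟨
    pairsCovered L + ∑[ i < n ] 1      ≡⟨ ∑-distrib-+ (degree L) (λ _ → 1) ⟨
    ∑[ i < n ] (degree L i + 1)        ≤⟨ sum-mono-≤ (degree+1≤n L) ⟩
    ∑[ i < n ] n                       ≡⟨ sum-const n n ⟩
    n * n                              ∎
    where open ≤-Reasoning

  count-others≡2 : {E : Subset n} {i : Fin n} → ∣ E ∣ ≡ 3 → i ∈ E → count (∁? (i ≟_) ∩? (_∈? E)) ≡ 2
  count-others≡2 ∣E∣≡3 i∈E = +-cancelʳ-≡ 1 _ 2 (trans (count-others i∈E) ∣E∣≡3)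

  6≤pairsCovered[E] : (E : Subset n) → ∣ E ∣ ≡ 3 → 6 ≤ pairsCovered [ E ]
  6≤pairsCovered[E] E ∣E∣≡3 = begin
    6                              ≡⟨ cong (2 *_) (trans (count-∈ E) ∣E∣≡3) ⟨
    2 * count (_∈? E)              ≡⟨ *-distribˡ-sum 2 (λ i → 𝟙 (i ∈? E)) ⟩
    ∑[ i < n ] (2 * 𝟙 (i ∈? E))    ≤⟨ sum-mono-≤ (λ i → row i (i ∈? E)) ⟩
    pairsCovered [ E ]             ∎
    where
    open ≤-Reasoning
    row : ∀ i (i∈?E : Dec (i ∈ E)) → 2 * 𝟙 i∈?E ≤ degree [ E ] i
    row i (no _)    = z≤n
    row i (yes i∈E) = begin
      2                                 ≡⟨ count-others≡2 ∣E∣≡3 i∈E ⟨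
      count (∁? (i ≟_) ∩? (_∈? E))      ≤⟨ count-mono (∁? (i ≟_) ∩? (_∈? E)) (adjacent? [ E ] i)
                                             (λ (i≢j , j∈E) → i≢j , here (i∈E , j∈E)) ⟩
      degree [ E ] i                    ∎

  pairsCovered-extend : (E : Subset n) (C : List (Subset n)) {w : Fin n} →
                        ∣ E ∣ ≡ 3 → w ∈ E → w ∉ ⋃ C → pairsCovered C + 4 ≤ pairsCovered (E ∷ C)
  pairsCovered-extend E C {w} ∣E∣≡3 w∈E w∉⋃C = begin
    pairsCovered C + 4
      ≡⟨ cong (pairsCovered C +_) (cong₂ _+_ (trans (count-∈ E) ∣E∣≡3) (count-≡ w)) ⟨
    pairsCovered C + (count (_∈? E) + count (_≟ w))
      ≡⟨ cong (pairsCovered C +_) (∑-distrib-+ (λ i → 𝟙 (i ∈? E)) (λ i → 𝟙 (i ≟ w))) ⟨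
    pairsCovered C + ∑[ i < n ] (𝟙 (i ∈? E) + 𝟙 (i ≟ w))
      ≡⟨ ∑-distrib-+ (degree C) (λ i → 𝟙 (i ∈? E) + 𝟙 (i ≟ w)) ⟨
    ∑[ i < n ] (degree C i + (𝟙 (i ∈? E) + 𝟙 (i ≟ w)))
      ≤⟨ sum-mono-≤ (λ i → row i (i ∈? E) (i ≟ w)) ⟩
    pairsCovered (E ∷ C) ∎
    where
    open ≤-Reasoning
    C⊆E∷C : ∀ {i} → Adjacent C i ⊆ Adjacent (E ∷ C) i
    C⊆E∷C (i≢j , covered) = i≢j , there covered
    row : ∀ i (i∈?E : Dec (i ∈ E)) (i≟w : Dec (i ≡ w)) →
          degree C i + (𝟙 i∈?E + 𝟙 i≟w) ≤ degree (E ∷ C) i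
    row i (no i∉E) (yes refl) = ⊥-elim (i∉E w∈E)
    row i (no _)   (no _)     = begin
      degree C i + 0   ≡⟨ +-identityʳ _ ⟩
      degree C i       ≤⟨ count-mono (adjacent? C i) (adjacent? (E ∷ C) i) C⊆E∷C ⟩
      degree (E ∷ C) i ∎
    row i (yes _) (yes refl) = begin
      degree C w + 2                                      ≡⟨ cong (degree C w +_) (count-others≡2 ∣E∣≡3 w∈E) ⟨
      degree C w + count (∁? (w ≟_) ∩? (_∈? E))           ≤⟨ count-∪-≤ (adjacent? C w) (∁? (w ≟_) ∩? (_∈? E)) (adjacent? (E ∷ C) w)
                                                               (λ (adj , _) → w∉⋃C (proj₁ (adjacent⇒∈⋃ adj)))
                                                               C⊆E∷C (λ (w≢j , j∈E) → w≢j , here (w∈E , j∈E)) ⟩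
      degree (E ∷ C) w                                    ∎
    row i (yes i∈E) (no i≢w) = begin
      degree C i + 1                     ≡⟨ cong (degree C i +_) (count-≡ w) ⟨
      degree C i + count (_≟ w)          ≤⟨ count-∪-≤ (adjacent? C i) (_≟ w) (adjacent? (E ∷ C) i)
                                              (λ (adj , j≡w) → w∉⋃C (subst (_∈ ⋃ C) j≡w (proj₂ (adjacent⇒∈⋃ adj))))
                                              C⊆E∷C (λ { refl → i≢w , here (i∈E , w∈E) }) ⟩
      degree (E ∷ C) i                   ∎

  Separated : List (Subset n) → List (Subset n) → Set
  Separated C R = ¬ Any (λ E → Any (SharePair E) C) R

  pairsCovered-++ : (C R : List (Subset n)) → Separated C R →
                    pairsCovered (C ++ R) ≡ pairsCovered C + pairsCovered R
  pairsCovered-++ C R sep = trans (sum-cong-≗ degree-++) (∑-distrib-+ (degree C) (degree R))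
    where
    split : ∀ {i} → Adjacent (C ++ R) i ⊆ Adjacent C i U.∪ Adjacent R i
    split (i≢j , covered) with Any.++⁻ C covered
    ... | inj₁ inC = inj₁ (i≢j , inC)
    ... | inj₂ inR = inj₂ (i≢j , inR)
    join : ∀ {i} → Adjacent C i U.∪ Adjacent R i ⊆ Adjacent (C ++ R) i
    join = [ (λ (i≢j , inC) → i≢j , Any.++⁺ˡ inC) , (λ (i≢j , inR) → i≢j , Any.++⁺ʳ C inR) ]′
    disjoint : ∀ {i} → Disjoint (Adjacent C i) (Adjacent R i)
    disjoint {i} {j} ((i≢j , inC) , (_ , inR)) with find inC | find inR
    ... | E′ , E′∈C , i∈E′ , j∈E′ | E , E∈R , i∈E , j∈E =
      sep (lose E∈R (lose E′∈C (i , j , i≢j , (i∈E , j∈E) , (i∈E′ , j∈E′))))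
    degree-++ : ∀ i → degree (C ++ R) i ≡ degree C i + degree R i
    degree-++ i = trans (count-cong (adjacent? (C ++ R) i) (adjacent? C i ∪? adjacent? R i) (split , join))
                        (count-∪ (adjacent? C i) (adjacent? R i) disjoint)

-- Clusters

-- Here k′ stands for k - 1.
module _ {n : ℕ} (F : Hypergraph3 n) (k′ : ℕ) (1≤k′ : 1 ≤ k′)
         (free-k : Free F (suc k′ + 2) (suc k′))
         (free-small : ∀ l → 2 ≤ l → l ≤ k′ → Free F (l + 1) l) where

  record Cluster (C : List (Subset n)) : Set where
    field
      ⊆edges      : All (_∈ₗ edges F) C
      unique      : Unique C
      nonempty    : 1 ≤ length C
      small       : length C ≤ k′
      fewVertices : ∣ ⋃ C ∣ ≤ length C + 2
      dense       : 2 * (2 * length C + 1) ≤ pairsCovered C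

  ∣E∣≡3 : {E : Subset n} → E ∈ₗ edges F → ∣ E ∣ ≡ 3
  ∣E∣≡3 = All.lookup (uniform F)

  singleton : {E : Subset n} → E ∈ₗ edges F → Cluster [ E ]
  singleton {E} E∈F = record
    { ⊆edges      = E∈F ∷ []
    ; unique      = [] ∷ []
    ; nonempty    = ≤-refl
    ; small       = 1≤k′
    ; fewVertices = ≤-reflexive (trans (cong ∣_∣ (∪-identityʳ E)) (∣E∣≡3 E∈F))
    ; dense       = 6≤pairsCovered[E] E (∣E∣≡3 E∈F)
    }

  extend : {C : List (Subset n)} {E : Subset n} → Cluster C → E ∈ₗ edges F → Unique (E ∷ C) →
           Any (SharePair E) C → Cluster (E ∷ C)
  extend {C} {E} cl E∈F uq share = record
    { ⊆edges      = E∈F ∷ ⊆edges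
    ; unique      = uq
    ; nonempty    = s≤s z≤n
    ; small       = c<k′
    ; fewVertices = fewVertices′
    ; dense       = dense′
    }
    where
    open Cluster cl
    c : ℕ
    c = length C
    fewVertices′ : ∣ E ∪ ⋃ C ∣ ≤ suc c + 2
    fewVertices′ = +-cancelʳ-≤ 2 _ _ (begin
      ∣ E ∪ ⋃ C ∣ + 2   ≤⟨ sharePair⇒∣E∪U∣+2≤∣E∣+∣U∣ E (⋃ C) (sharePair-⋃⁺ share) ⟩
      ∣ E ∣ + ∣ ⋃ C ∣   ≤⟨ +-mono-≤ (≤-reflexive (∣E∣≡3 E∈F)) fewVertices ⟩
      3 + (c + 2)       ≡⟨ regroup c ⟩
      suc c + 2 + 2     ∎)
      where
      open ≤-Reasoning
      regroup : ∀ c → 3 + (c + 2) ≡ suc c + 2 + 2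
      regroup = solve-∀
    -- A cluster of k′ edges together with E would be a (k + 2, k)-configuration.
    c<k′ : c < k′
    c<k′ with m≤n⇒m<n∨m≡n small
    ... | inj₁ c<k′ = c<k′
    ... | inj₂ c≡k′ = ⊥-elim (free-k (E ∷ C , E∈F ∷ ⊆edges , uq , cong suc c≡k′ ,
                                      subst (λ m → ∣ E ∪ ⋃ C ∣ ≤ suc m + 2) c≡k′ fewVertices′))
    -- (suc c + 1, suc c)-freeness forces E to bring a vertex outside ⋃ C.
    ⋃C<⋃E∷C : ∣ ⋃ C ∣ < ∣ E ∪ ⋃ C ∣
    ⋃C<⋃E∷C = ≤-<-trans fewVertices (subst (_< ∣ E ∪ ⋃ C ∣) (sym (+-suc c 1))
                (≰⇒> λ few → free-small (suc c) (s≤s nonempty) c<k′ (E ∷ C , E∈F ∷ ⊆edges , uq , refl , few)))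
    dense′ : 2 * (2 * suc c + 1) ≤ pairsCovered (E ∷ C)
    dense′ with ∣U∣<∣E∪U∣⇒∃∈E∖U E (⋃ C) ⋃C<⋃E∷C
    ... | w , w∈E , w∉⋃C = begin
      2 * (2 * suc c + 1)         ≡⟨ step c ⟩
      2 * (2 * c + 1) + 4         ≤⟨ +-monoˡ-≤ 4 dense ⟩
      pairsCovered C + 4          ≤⟨ pairsCovered-extend E C (∣E∣≡3 E∈F) w∈E w∉⋃C ⟩
      pairsCovered (E ∷ C)        ∎
      where
      open ≤-Reasoning
      step : ∀ c → 2 * (2 * suc c + 1) ≡ 2 * (2 * c + 1) + 4
      step = solve-∀

  close : {C R : List (Subset n)} → Acc _<_ (length R) → Cluster C → All (_∈ₗ edges F) R →
          Unique (C ++ R) → ∃₂ λ C′ R′ → C ++ R ↭ C′ ++ R′ × Cluster C′ × Separated C′ R′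
  close {C} {R} (acc smaller) cl R⊆F uq with anyₗ? (λ E → anyₗ? (sharePair? E) C) R
  ... | no separated = C , R , ↭-refl , cl , separated
  ... | yes sharing with find sharing
  ...   | E , E∈R , share with ∈-∃++ E∈R
  ...     | R₁ , R₂ , refl =
    let (C′ , R″ , ↭C′++R″ , cl′ , separated) = close (smaller shorter) (extend cl E∈F uqE∷C share) R′⊆F uq′
    in  C′ , R″ , ↭-trans moveE ↭C′++R″ , cl′ , separated
    where
    R′ : List (Subset n)
    R′ = R₁ ++ R₂
    moveE : C ++ (R₁ ++ E ∷ R₂) ↭ E ∷ C ++ R′
    moveE = ↭-trans (++⁺ˡ C (shift E R₁ R₂)) (shift E C R′)
    uq′ : Unique (E ∷ C ++ R′)
    uq′ = Unique-resp-↭ moveE uq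
    uqE∷C : Unique (E ∷ C)
    uqE∷C = proj₁ (Unique-++⁻ (E ∷ C) uq′)
    E∈F : E ∈ₗ edges F
    E∈F = All.lookup R⊆F E∈R
    R′⊆F : All (_∈ₗ edges F) R′
    R′⊆F = All.++⁻ʳ (E ∷ C) (All-resp-↭ moveE (All.++⁺ (Cluster.⊆edges cl) R⊆F))
    shorter : length R′ < length (R₁ ++ E ∷ R₂)
    shorter = ≤-reflexive (sym (length-++-sucʳ R₁ E R₂))

  cluster-density : {C : List (Subset n)} → Cluster C → 2 * ((2 * k′ + 1) * length C) ≤ k′ * pairsCovered C
  cluster-density {C} cl = begin
    2 * ((2 * k′ + 1) * c)       ≡⟨ expand k′ c ⟩
    4 * k′ * c + 2 * c           ≤⟨ +-monoʳ-≤ (4 * k′ * c) (*-monoʳ-≤ 2 small) ⟩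
    4 * k′ * c + 2 * k′          ≡⟨ factor k′ c ⟩
    k′ * (2 * (2 * c + 1))       ≤⟨ *-monoʳ-≤ k′ dense ⟩
    k′ * pairsCovered C          ∎
    where
    open ≤-Reasoning
    open Cluster cl
    c : ℕ
    c = length C
    expand : ∀ k c → 2 * ((2 * k + 1) * c) ≡ 4 * k * c + 2 * c
    expand = solve-∀
    factor : ∀ k c → 4 * k * c + 2 * k ≡ k * (2 * (2 * c + 1))
    factor = solve-∀

  density : {L : List (Subset n)} → Acc _<_ (length L) → All (_∈ₗ edges F) L → Unique L →
            2 * ((2 * k′ + 1) * length L) ≤ k′ * pairsCovered L
  density {[]}    _            _              _  = ≤-trans (≤-reflexive (cong (2 *_) (*-zeroʳ (2 * k′ + 1)))) z≤n
  density {E ∷ L} (acc smaller) (E∈F ∷ L⊆F) uq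
    with close (<-wellFounded (length L)) (singleton E∈F) L⊆F uq
  ... | C , R , E∷L↭C++R , cl , separated = begin
    2 * ((2 * k′ + 1) * length (E ∷ L))                      ≡⟨ cong (λ m → 2 * ((2 * k′ + 1) * m)) length-E∷L ⟩
    2 * ((2 * k′ + 1) * (length C + length R))               ≡⟨ distrib (2 * k′ + 1) (length C) (length R) ⟩
    2 * ((2 * k′ + 1) * length C) + 2 * ((2 * k′ + 1) * length R)
                                                             ≤⟨ +-mono-≤ (cluster-density cl) (density (smaller shorter) R⊆F uqR) ⟩
    k′ * pairsCovered C + k′ * pairsCovered R                 ≡⟨ *-distribˡ-+ k′ (pairsCovered C) (pairsCovered R) ⟨
    k′ * (pairsCovered C + pairsCovered R)                   ≡⟨ cong (k′ *_) (pairsCovered-++ C R separated) ⟨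
    k′ * pairsCovered (C ++ R)                               ≡⟨ cong (k′ *_) (pairsCovered-↭ E∷L↭C++R) ⟨
    k′ * pairsCovered (E ∷ L)                                ∎
    where
    open ≤-Reasoning
    distrib : ∀ a c r → 2 * (a * (c + r)) ≡ 2 * (a * c) + 2 * (a * r)
    distrib = solve-∀
    length-E∷L : length (E ∷ L) ≡ length C + length R
    length-E∷L = trans (↭-length E∷L↭C++R) (length-++ C)
    shorter : length R < length (E ∷ L)
    shorter = ≤-trans (+-monoˡ-≤ (length R) (Cluster.nonempty cl)) (≤-reflexive (sym length-E∷L))
    R⊆F : All (_∈ₗ edges F) R
    R⊆F = All.++⁻ʳ C (All-resp-↭ E∷L↭C++R (E∈F ∷ L⊆F))
    uqR : Unique R
    uqR = proj₂ (Unique-++⁻ C (Unique-resp-↭ E∷L↭C++R uq))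

  edge-density : 2 * ((2 * k′ + 1) * e F) ≤ k′ * pairsCovered (edges F)
  edge-density = density (<-wellFounded _) (All.tabulate (λ E∈F → E∈F)) (distinct F)

-- Binomial coefficients

-- Imported only here because _C_ would make the cluster variable C above ambiguous.
open import Data.Nat.Combinatorics using (_C_; nCk+nC[k+1]≡[n+1]C[k+1]; nC1≡n)

2*nC2+n≡n*n : ∀ n → 2 * (n C 2) + n ≡ n * n
2*nC2+n≡n*n zero    = refl
2*nC2+n≡n*n (suc n) = begin
  2 * (suc n C 2) + suc n           ≡⟨ cong (λ m → 2 * m + suc n) (nCk+nC[k+1]≡[n+1]C[k+1] n 1) ⟨
  2 * (n C 1 + n C 2) + suc n       ≡⟨ cong (λ m → 2 * (m + n C 2) + suc n) (nC1≡n n) ⟩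
  2 * (n + n C 2) + suc n           ≡⟨ regroup n (n C 2) ⟩
  (2 * (n C 2) + n) + 2 * n + 1     ≡⟨ cong (λ m → m + 2 * n + 1) (2*nC2+n≡n*n n) ⟩
  n * n + 2 * n + 1                 ≡⟨ square n ⟩
  suc n * suc n                     ∎
  where
  open ≡-Reasoning
  regroup : ∀ n x → 2 * (n + x) + suc n ≡ (2 * x + n) + 2 * n + 1
  regroup = solve-∀
  square : ∀ n → n * n + 2 * n + 1 ≡ suc n * suc n
  square = solve-∀

pairsCovered≤2*nC2 : (L : List (Subset n)) → pairsCovered L ≤ 2 * (n C 2)
pairsCovered≤2*nC2 {n} L = +-cancelʳ-≤ n _ _ (≤-trans (pairsCovered+n≤n*n L) (≤-reflexive (sym (2*nC2+n≡n*n n))))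

binomial-bound : ∀ k c n → (4 * k ∸ 2) * (c * (n C 2)) ≤ (2 * k ∸ 1) * (c * (n * n))
binomial-bound k c n = begin
  (4 * k ∸ 2) * (c * X)           ≡⟨ cong (_* (c * X)) (trans (*-distribˡ-∸ 2 (2 * k) 1) (cong (_∸ 2) (sym (*-assoc 2 2 k)))) ⟨
  2 * (2 * k ∸ 1) * (c * X)       ≡⟨ swap (2 * k ∸ 1) c X ⟩
  (2 * k ∸ 1) * (c * (2 * X))     ≤⟨ *-monoʳ-≤ (2 * k ∸ 1) (*-monoʳ-≤ c 2X≤n*n) ⟩
  (2 * k ∸ 1) * (c * (n * n))     ∎
  where
  open ≤-Reasoning
  X : ℕ
  X = n C 2
  swap : ∀ a c x → 2 * a * (c * x) ≡ a * (c * (2 * x))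
  swap = solve-∀
  2X≤n*n : 2 * X ≤ n * n
  2X≤n*n = subst (2 * X ≤_) (2*nC2+n≡n*n n) (m≤m+n (2 * X) n)

lemma2p4 : (k n : ℕ) → 2 ≤ k → (F : Hypergraph3 n) →
    Free F (k + 2) k →
    ((l : ℕ) → 2 ≤ l → l ≤ k ∸ 1 → Free F (l + 1) l) →
    ((2 * k ∸ 1) * e F ≤ (k ∸ 1) * (v F C 2))
    × ((4 * k ∸ 2) * ((k ∸ 1) * (v F C 2)) ≤ (2 * k ∸ 1) * ((k ∸ 1) * (v F * v F)))
lemma2p4 (suc k′@(suc _)) n (s≤s (s≤s z≤n)) F free-k free-small = edge-bound , binomial-bound (suc k′) k′ n
  where
  edge-bound : (2 * suc k′ ∸ 1) * e F ≤ k′ * (n C 2)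
  edge-bound = begin
    (2 * suc k′ ∸ 1) * e F     ≡⟨ cong (_* e F) (trans (cong (_∸ 1) (*-suc 2 k′)) (+-comm 1 (2 * k′))) ⟩
    (2 * k′ + 1) * e F         ≤⟨ *-cancelˡ-≤ 2 (begin
      2 * ((2 * k′ + 1) * e F)     ≤⟨ edge-density F k′ (s≤s z≤n) free-k free-small ⟩
      k′ * pairsCovered (edges F)  ≤⟨ *-monoʳ-≤ k′ (pairsCovered≤2*nC2 (edges F)) ⟩
      k′ * (2 * (n C 2))           ≡⟨ x*[2*y]≡2*[x*y] k′ (n C 2) ⟩
      2 * (k′ * (n C 2))           ∎) ⟩
    k′ * (n C 2)               ∎
    where
    open ≤-Reasoning
    x*[2*y]≡2*[x*y] : ∀ x y → x * (2 * y) ≡ 2 * (x * y)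
    x*[2*y]≡2*[x*y] = solve-∀
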